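{- Let $r\in\mathbb Z$ and let $K$ be an $r$-conic simplicial complex. Let $t\in\mathbb N$, $t\ge1$, and let $v_1,\dots,v_t$ be vertices of $K$. Then $S=\bigcap_{i=1}^t\mathrm{St}_K(v_i)$ is $(r-t)$-conic. In particular, if $t\le r$, then $S$ is non-empty.
   Context: For a vertex $v$ of $K$, the closed star $\mathrm{St}_K(v)$ is the subcomplex of $K$ consisting of all simplexes $\sigma$ such that $\sigma\cup\{v\}$ is a simplex of $K$ (together with their faces). For $r\in\mathbb Z$, a simplicial complex $K$ is $r$-conic if every subcomplex $L\le K$ with at most $r$ vertices (including the empty subcomplex) is contained in $\mathrm{St}_K(v)$ for some vertex $v$ of $K$. Thus $0$-conic and $1$-conic both mean non-empty, and every complex is $r$-conic for $r\le-1$. -}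

module Defs where

open import Data.Nat using (ℕ)
open import Data.Integer using (ℤ; +_; _≤_)
open import Data.Fin using (Fin)
open import Data.List using (List; []; _∷_; length)
open import Data.List.Membership.Propositional using (_∈_)
open import Data.List.Relation.Binary.Subset.Propositional using (_⊆_)
open import Data.List.Relation.Unary.Any using (here; there)
open import Data.Product using (Σ; ∃; _×_; _,_)

-- An abstract simplicial complex with vertices drawn from a type V:
-- a collection of finite vertex sets (represented as lists; order and
-- repetition are irrelevant because membership is closed under ⊆)
-- which is closed under taking faces.
record Complex (V : Set) : Set₁ where
  field
    simplex : List V → Set
    down    : ∀ {σ τ} → simplex σ → τ ⊆ σ → simplex τ
open Complex public

Vertex : ∀ {V} → Complex V → V → Set
Vertex K v = simplex K (v ∷ [])

NonEmpty : ∀ {V} → Complex V → Set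
NonEmpty {V} K = Σ V λ v → Vertex K v

_≤ᶜ_ : ∀ {V} → Complex V → Complex V → Set
L ≤ᶜ K = ∀ σ → simplex L σ → simplex K σ

AtMostVertices : ∀ {V} → ℤ → Complex V → Set
AtMostVertices {V} r L = Σ (List V) λ ws → (+ length ws ≤ r) × (∀ w → Vertex L w → w ∈ ws)

private
  cons-⊆ : ∀ {V : Set} {v : V} {σ τ : List V} → τ ⊆ σ → (v ∷ τ) ⊆ (v ∷ σ)
  cons-⊆ p (here eq) = here eq
  cons-⊆ p (there x) = there (p x)

St : ∀ {V} → Complex V → V → Complex V
St K v = record
  { simplex = λ σ → simplex K (v ∷ σ)
  ; down = λ s p → down K s (cons-⊆ p) }

InStar : ∀ {V} → Complex V → Complex V → V → Set
InStar K L v = Vertex K v × (L ≤ᶜ St K v)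

Conic : ∀ {V} → ℤ → Complex V → Set₁
Conic {V} r K = (L : Complex V) → L ≤ᶜ K → AtMostVertices r L → Σ V λ v → InStar K L v

⋂St : ∀ {V} (K : Complex V) (t : ℕ) → (Fin t → V) → Complex V
⋂St K t vs = record
  { simplex = λ σ → ∀ i → simplex (St K (vs i)) σ
  ; down = λ s p i → down (St K (vs i)) (s i) p }

-- Given L ≤ ⋂ᵢ St(vᵢ) with at most r − t vertices, form the union L′ of the cones vᵢ * L.
-- L′ lies in K and has at most r vertices, so r-conicity of K puts L′ inside some St_K(v).
-- Then every vᵢ * {v} and every vᵢ * σ * {v} (σ ∈ L) is a simplex of K, which says exactly
-- that v is a vertex of ⋂ᵢ St(vᵢ) whose star contains L. Taking L empty gives non-emptiness.
module Submission where

open import Defs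
open import Data.Nat using (ℕ)
open import Data.Integer using (ℤ; +_; _-_; _≤_)
open import Data.Fin using (Fin)
open import Data.Product using (_×_; Σ; ∃₂; _,_; proj₁; map₂)
open import Data.Sum using (_⊎_; inj₁; inj₂)
open import Data.Empty using (⊥)
open import Data.List using (List; []; _∷_; length; _++_; tabulate)
open import Data.List.Properties using (length-++; length-tabulate)
open import Data.List.Membership.Propositional using (_∈_)
open import Data.List.Membership.Propositional.Properties using (∈-++⁺ˡ; ∈-++⁺ʳ; ∈-tabulate⁺)
open import Data.List.Relation.Binary.Subset.Propositional using (_⊆_)
open import Data.List.Relation.Binary.Subset.Propositional.Properties using (⊆-refl; ⊆-reflexive-↭)
open import Data.List.Relation.Binary.Permutation.Propositional using (swap; ↭-refl)
open import Data.List.Relation.Unary.Any using (here; there)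
open import Data.Integer.Properties using (+-0-abelianGroup; pos-+; +-monoˡ-≤; i≤j⇒0≤j-i)
open import Algebra.Properties.AbelianGroup +-0-abelianGroup using (//-rightDividesˡ)
open import Relation.Binary.PropositionalEquality using (_≡_; refl; subst)
import Data.Integer as ℤ

∅ᶜ : ∀ {V} → Complex V
∅ᶜ = record { simplex = λ _ → ⊥ ; down = λ () }

-- The apex {vᵢ} is included separately because L need not contain the empty simplex.
⋃Cone : ∀ {V} (L : Complex V) (t : ℕ) → (Fin t → V) → Complex V
⋃Cone L t vs = record
  { simplex = λ τ → ∃₂ λ i σ → (simplex L σ ⊎ σ ≡ []) × τ ⊆ vs i ∷ σ
  ; down    = λ { (i , σ , s , τ⊆) υ⊆τ → i , σ , s , λ x → τ⊆ (υ⊆τ x) } }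

swap⊆ : ∀ {V : Set} (a b : V) (σ : List V) → a ∷ b ∷ σ ⊆ b ∷ a ∷ σ
swap⊆ a b σ = ⊆-reflexive-↭ (swap a b ↭-refl)

⋃Cone≤ᶜ : ∀ {V} (K L : Complex V) (t : ℕ) (vs : Fin t → V) →
  (∀ i → Vertex K (vs i)) → L ≤ᶜ ⋂St K t vs → ⋃Cone L t vs ≤ᶜ K
⋃Cone≤ᶜ K L t vs vK L≤⋂St τ (i , σ , inj₁ σ∈L , τ⊆) = down K (L≤⋂St σ σ∈L i) τ⊆
⋃Cone≤ᶜ K L t vs vK L≤⋂St τ (i , .[] , inj₂ refl , τ⊆) = down K (vK i) τ⊆

⋃Cone-vertex : ∀ {V} (L : Complex V) (t : ℕ) (vs : Fin t → V) {w : V} →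
  Vertex (⋃Cone L t vs) w → (Σ (Fin t) λ i → w ≡ vs i) ⊎ Vertex L w
⋃Cone-vertex L t vs (i , σ , s , w⊆) with s | w⊆ (here refl)
... | _         | here w≡vsᵢ = inj₁ (i , w≡vsᵢ)
... | inj₁ σ∈L  | there w∈σ  = inj₂ (down L σ∈L λ { (here refl) → w∈σ })
... | inj₂ refl | there ()

⋃Cone-atMostVertices : ∀ {V} (L : Complex V) (t : ℕ) (vs : Fin t → V) (a : ℤ) →
  AtMostVertices a L → AtMostVertices (a ℤ.+ + t) (⋃Cone L t vs)
⋃Cone-atMostVertices L t vs a (ws , |ws|≤a , ws-covers) =
  ws ++ tabulate vs , length-bound , covers
  where
  length-bound : + length (ws ++ tabulate vs) ≤ a ℤ.+ + t
  length-bound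
    rewrite length-++ ws {tabulate vs} | length-tabulate vs | pos-+ (length ws) t
    = +-monoˡ-≤ (+ t) |ws|≤a
  covers : ∀ w → Vertex (⋃Cone L t vs) w → w ∈ ws ++ tabulate vs
  covers w w∈cones with ⋃Cone-vertex L t vs w∈cones
  ... | inj₁ (i , refl) = ∈-++⁺ʳ ws (∈-tabulate⁺ i)
  ... | inj₂ w∈L        = ∈-++⁺ˡ (ws-covers w w∈L)

InStar-⋃Cone⇒InStar-⋂St : ∀ {V} (K L : Complex V) (t : ℕ) (vs : Fin t → V) (v : V) →
  InStar K (⋃Cone L t vs) v → InStar (⋂St K t vs) L v
InStar-⋃Cone⇒InStar-⋂St K L t vs v (_ , cones≤St) = v∈⋂St , L≤St
  where
  v∈⋂St : Vertex (⋂St K t vs) v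
  v∈⋂St i = down K (cones≤St (vs i ∷ []) (i , [] , inj₂ refl , ⊆-refl)) (swap⊆ (vs i) v [])
  L≤St : L ≤ᶜ St (⋂St K t vs) v
  L≤St σ σ∈L i = down K (cones≤St (vs i ∷ σ) (i , σ , inj₁ σ∈L , ⊆-refl)) (swap⊆ (vs i) v σ)

Conic-⋂St : ∀ {V} (r : ℤ) (K : Complex V) → Conic r K →
  (t : ℕ) (vs : Fin t → V) → (∀ i → Vertex K (vs i)) → Conic (r - + t) (⋂St K t vs)
Conic-⋂St r K conic t vs vK L L≤⋂St L-small =
  map₂ (InStar-⋃Cone⇒InStar-⋂St K L t vs _)
       (conic (⋃Cone L t vs) (⋃Cone≤ᶜ K L t vs vK L≤⋂St) cones-small)
  where
  cones-small : AtMostVertices r (⋃Cone L t vs)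
  cones-small = subst (λ a → AtMostVertices a (⋃Cone L t vs)) (//-rightDividesˡ (+ t) r)
                  (⋃Cone-atMostVertices L t vs (r - + t) L-small)

Conic⇒NonEmpty : ∀ {V} (r : ℤ) (K : Complex V) → Conic r K → + 0 ≤ r → NonEmpty K
Conic⇒NonEmpty r K conic 0≤r = map₂ proj₁ (conic ∅ᶜ (λ _ ()) ([] , 0≤r , λ _ ()))

mainTheorem17 : {V : Set} (r : ℤ) (K : Complex V) → Conic r K →
    (t : ℕ) → + 1 ≤ + t → (vs : Fin t → V) → (∀ i → Vertex K (vs i)) →
    Conic (r - + t) (⋂St K t vs) × (+ t ≤ r → NonEmpty (⋂St K t vs))
mainTheorem17 r K conic t _ vs vK =
  S-conic , λ t≤r → Conic⇒NonEmpty (r - + t) (⋂St K t vs) S-conic (i≤j⇒0≤j-i t≤r)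
  where
  S-conic : Conic (r - + t) (⋂St K t vs)
  S-conic = Conic-⋂St r K conic t vs vK
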